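{- Let $G_1$ and $G_2$ be trees, each with $n+1$ vertices and $n$ edges, with edge numerations $N_1,N_2$. Let $e_1,\dots,e_n$ be the standard basis of $\mathbb{R}^n$ (the space of $MA(G_1,N_1)$), $e_i$ corresponding to the edge of $G_1$ numbered $i$, and let $e^1,\dots,e^n$ be the standard basis of the space of $MA(G_2,N_2)$, defined likewise for $G_2$. Let $u$ be a vertex of $G_1$ and $v$ a vertex of $G_2$. Choose a set $S_1$ of normal vectors, one for each hyperplane of $MA(G_1,N_1)$, as follows: for the hyperplane $x_i=0$ choose $e_i$; for a hyperplane corresponding to a simple path with endpoint $u$, listed as $(r_1,\dots,r_k)$ with $r_1$ incident to $u$, choose $e_{N_1(r_1)}-e_{N_1(r_2)}+e_{N_1(r_3)}-\dots$; for every other hyperplane choose either of its two normal vectors of the form $\pm(e_{i_1}-e_{i_2}+e_{i_3}-\dots)$ arbitrarily. Let $M_1$ be the matroid on $S_1$ whose independent sets are the linearly independent subsets. Then one can choose a set $S_2$ of normal vectors, one for each hyperplane of $MA(G_2,N_2)$, each of the form $\pm(e^{j_1}-e^{j_2}+e^{j_3}-\dots)$ for the corresponding path, such that, with $M_2$ the matroid on $S_2$ of linearly independent subsets, there is a matroid isomorphism $F:S_1\to S_2$ with the property that whenever $a\in S_1$ corresponds to a simple path with endpoint $u$, $F(a)$ corresponds to a simple path with endpoint $v$.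
   Context: For a graph $H$ with $m$ edges and numeration (bijection) $N:E(H)\to\{1,\dots,m\}$, the matching arrangement $MA(H,N)$ consists of the hyperplanes $x_{N(r_1)}-x_{N(r_2)}+\dots+(-1)^{k+1}x_{N(r_k)}=0$ in $\mathbb{R}^m$ for every sequence $(r_1,\dots,r_k)$, $k\ge1$, of edges forming a simple path (or a simple cycle with an even number of edges) of $H$; in a tree only paths occur. A matroid isomorphism between matroids on ground sets $S_1,S_2$ is a bijection $F:S_1\to S_2$ such that a subset $X\subseteq S_1$ is independent if and only if $F(X)$ is independent. -}

module Defs where

open import Data.Nat using (ℕ; suc)
open import Data.Fin using (Fin; _≟_)
open import Data.Bool using (if_then_else_)
open import Data.Product using (Σ; _×_; _,_)
open import Data.Sum using (_⊎_)
open import Data.List using (List; []; _∷_; length; lookup; map)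
open import Data.Vec as V using (Vec)
open import Data.Rational using (ℚ; 0ℚ; 1ℚ; _+_; _-_; _*_; -_)
open import Relation.Binary.PropositionalEquality using (_≡_; _≢_)
open import Relation.Nullary using (¬_)
open import Relation.Nullary.Decidable using (⌊_⌋)
open import Data.List.Relation.Unary.Unique.Propositional using (Unique)
open import Data.List.Relation.Unary.All using (All)
open import Data.List.Membership.Propositional using (_∈_)
open import Function.Bundles using (_⇔_; _⤖_; Bijection)

-- The edge with label i is the edge numbered i by the numeration N
-- (so N is the identity on labels).
Graph : ℕ → Set
Graph n = Fin n → Fin (suc n) × Fin (suc n)

Joins : ∀ {n} → Graph n → Fin n → Fin (suc n) → Fin (suc n) → Set
Joins G e a b = (G e ≡ (a , b)) ⊎ (G e ≡ (b , a))

data Walk {n} (G : Graph n) : Fin (suc n) → Fin (suc n) → Set where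
  [] : ∀ {a} → Walk G a a
  step : ∀ {a b c} (e : Fin n) → Joins G e a b → Walk G b c → Walk G a c

verts : ∀ {n} {G : Graph n} {a b} → Walk G a b → List (Fin (suc n))
verts {a = a} [] = a ∷ []
verts {a = a} (step e _ w) = a ∷ verts w

edgesOf : ∀ {n} {G : Graph n} {a b} → Walk G a b → List (Fin n)
edgesOf [] = []
edgesOf (step e _ w) = e ∷ edgesOf w

tailVerts : ∀ {n} {G : Graph n} {a b} → Walk G a b → List (Fin (suc n))
tailVerts [] = []
tailVerts (step e _ w) = verts w

IsSimplePath : ∀ {n} {G : Graph n} {a b} → Walk G a b → Set
IsSimplePath w = (edgesOf w ≢ []) × Unique (verts w)

IsSimpleCycle : ∀ {n} {G : Graph n} {a} → Walk G a a → Set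
IsSimpleCycle w = (edgesOf w ≢ []) × Unique (edgesOf w) × Unique (tailVerts w)

Connected : ∀ {n} → Graph n → Set
Connected G = ∀ a b → Walk G a b

Acyclic : ∀ {n} → Graph n → Set
Acyclic G = ∀ a (w : Walk G a a) → ¬ IsSimpleCycle w

IsTree : ∀ {n} → Graph n → Set
IsTree G = Connected G × Acyclic G

record SimplePath {n} (G : Graph n) : Set where
  constructor mkPath
  field
    start : Fin (suc n)
    end   : Fin (suc n)
    walk  : Walk G start end
    simple : IsSimplePath walk
open SimplePath public

zeroV : ∀ {n} → Vec ℚ n
zeroV = V.replicate _ 0ℚ

negV : ∀ {n} → Vec ℚ n → Vec ℚ n
negV = V.map (λ x → - x)

unitV : ∀ {n} → Fin n → Vec ℚ n
unitV i = V.tabulate (λ j → if ⌊ j ≟ i ⌋ then 1ℚ else 0ℚ)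

altVec : ∀ {n} → List (Fin n) → Vec ℚ n
altVec [] = zeroV
altVec (e ∷ es) = V.zipWith _-_ (unitV e) (altVec es)

normal : ∀ {n} {G : Graph n} → SimplePath G → Vec ℚ n
normal p = altVec (edgesOf (walk p))

IsNormalOf : ∀ {n} {G : Graph n} → Vec ℚ n → SimplePath G → Set
IsNormalOf x p = (x ≡ normal p) ⊎ (x ≡ negV (normal p))

NormalChoice : ∀ {n} → Graph n → List (Vec ℚ n) → Set
NormalChoice G S =
  Unique S
  × (∀ {x} → x ∈ S → Σ (SimplePath G) (λ p → IsNormalOf x p))
  × (∀ (p : SimplePath G) → (normal p ∈ S) ⊎ (negV (normal p) ∈ S))
  × (∀ (p : SimplePath G) → ¬ ((normal p ∈ S) × (negV (normal p) ∈ S)))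

lincomb : ∀ {n} → List ℚ → List (Vec ℚ n) → Vec ℚ n
lincomb (c ∷ cs) (v ∷ vs) = V.zipWith _+_ (V.map (c *_) v) (lincomb cs vs)
lincomb _ _ = zeroV

LinIndep : ∀ {n} → List (Vec ℚ n) → Set
LinIndep vs = ∀ (cs : List ℚ) → length cs ≡ length vs → lincomb cs vs ≡ zeroV → All (_≡ 0ℚ) cs

-- F is a matroid isomorphism between the linear matroids on S₁ and S₂
-- (elements of Sᵢ addressed by their positions; subsets = duplicate-free index lists)
IsMatroidIso : ∀ {n} (S₁ S₂ : List (Vec ℚ n)) → (Fin (length S₁) ⤖ Fin (length S₂)) → Set
IsMatroidIso S₁ S₂ F =
  ∀ (X : List (Fin (length S₁))) → Unique X →
    LinIndep (map (lookup S₁) X) ⇔ LinIndep (map (λ i → lookup S₂ (Bijection.to F i)) X)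

CorrEndpoint : ∀ {n} → Graph n → Fin (suc n) → Vec ℚ n → Set
CorrEndpoint G w x =
  Σ (SimplePath G) (λ p → ((start p ≡ w) ⊎ (end p ≡ w)) × IsNormalOf x p)

{-# OPTIONS --safe #-}
-- Write ⟪ e₁ … e_k ⟫ = ((-1)^k , e₁ - e₂ + … ± e_k) ∈ ℚ × ℚⁿ.  For the product
-- (s , a) ∙ (t , b) = (s t , a + s b), ⟪_⟫ turns concatenation of edge sequences into ∙, and it does
-- not see a back-and-forth e e.  In an acyclic graph a nonempty closed walk that is not a simple cycle
-- reduces to two shorter closed walks, so ⟪ w ⟫ = (1 , 0) for every closed walk w.  Rooting a tree
-- at r and writing (s_x , c_x) = ⟪ a walk from r to x ⟫, every walk from x to y therefore has
-- alternating sum s_x (c_y - c_x): the normal of the path between x and y is ±(c_y - c_x).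
-- Root G₁ at u and G₂ at v and let σ swap u and v.  The linear map Λ with Λ c_x = c′_(σ x) has an
-- inverse of the same form, so S₂ = Λ S₁ is a normal choice for G₂ with the same linear matroid,
-- and Λ sends a normal of the path x–y to a normal of the path σx–σy.
module Submission where

open import Defs
open import Data.Nat using (ℕ; zero; suc; _<_; s≤s; z≤n)
open import Data.Nat.Properties using (≤-trans; n≤1+n)
open import Data.Nat.Induction using (<-wellFounded)
open import Induction.WellFounded using (Acc; acc)
import Data.Nat as ℕ
open import Data.Fin using (Fin; zero; suc; _≟_; cast)
open import Data.Fin.Properties using (cast-involutive)
open import Data.Fin.Permutation.Components using (transpose; transpose-inverse)
open import Data.Product using (Σ; _×_; _,_; proj₁; proj₂)
open import Data.Sum using (_⊎_; inj₁; inj₂) renaming (map to ⊎-map)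
open import Data.List as L using (List; []; _∷_; length; lookup; _++_)
open import Data.List.Properties using (length-map; map-cong; map-∘; length-++; length-++-≤ˡ; length-++-≤ʳ)
open import Data.List.Relation.Unary.Any using (here; there; any?)
import Data.List.Relation.Unary.All as All
open import Data.List.Relation.Unary.All.Properties using (¬Any⇒All¬)
open import Data.List.Relation.Unary.AllPairs using ([]; _∷_)
open import Data.List.Relation.Unary.Unique.Propositional using (Unique)
open import Data.List.Membership.Propositional using (_∈_)
open import Data.List.Membership.Propositional.Properties using (∈-map⁺; ∈-map⁻)
open import Data.List.Relation.Unary.Unique.Propositional.Properties using (map⁺)
open import Data.Empty using (⊥; ⊥-elim)
open import Relation.Nullary using (¬_; yes; no)
open import Relation.Nullary.Decidable using (⌊_⌋; dec-true)
open import Data.Bool using (if_then_else_)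
open import Data.Vec as V using (Vec; []; _∷_)
open import Data.Vec.Properties
  using (∷-injective; lookup∘tabulate; map-id; map-const; map-replicate; zipWith-identityˡ; zipWith-identityʳ;
         tabulate-allFin; tabulate-cong; tabulate-∘)
  renaming (map-cong to map-congᵛ)
open import Data.Rational using (ℚ; 0ℚ; 1ℚ; _+_; _-_; _*_; -_)
open import Data.Rational.Properties using (+-identityˡ; +-identityʳ; *-identityˡ; *-zeroʳ)
open import Data.Rational.Solver using (module +-*-Solver)
open import Relation.Binary.PropositionalEquality
open import Function.Bundles using (_⇔_; mk⇔; _⤖_; Bijection; mk↔ₛ′)
open import Function.Properties.Inverse using (↔⇒⤖)
open import Function.Definitions using (Injective)
open +-*-Solver using (solve; _:=_; _:+_; _:-_; _:*_; :-_; con)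

private variable
  n m : ℕ

infixl 6 _⊕_ _⊖_
infixr 7 _·_

_⊕_ _⊖_ : Vec ℚ n → Vec ℚ n → Vec ℚ n
_⊕_ = V.zipWith _+_
_⊖_ = V.zipWith _-_

_·_ : ℚ → Vec ℚ n → Vec ℚ n
k · v = V.map (k *_) v

⊕-identityˡ : (v : Vec ℚ n) → zeroV ⊕ v ≡ v
⊕-identityˡ = zipWith-identityˡ +-identityˡ

⊕-identityʳ : (v : Vec ℚ n) → v ⊕ zeroV ≡ v
⊕-identityʳ = zipWith-identityʳ +-identityʳ

·-identityˡ : (v : Vec ℚ n) → 1ℚ · v ≡ v
·-identityˡ v = trans (map-congᵛ *-identityˡ v) (map-id v)

·-zeroʳ : ∀ k → k · zeroV {n} ≡ zeroV
·-zeroʳ k = trans (map-replicate (k *_) 0ℚ _) (cong (V.replicate _) (*-zeroʳ k))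

·-zeroˡ : (v : Vec ℚ n) → 0ℚ · v ≡ zeroV
·-zeroˡ [] = refl
·-zeroˡ (x ∷ v) = cong₂ _∷_ (solve 1 (λ x → con 0ℚ :* x := con 0ℚ) refl x) (·-zeroˡ v)

⊖-identityʳ : (v : Vec ℚ n) → v ⊖ zeroV ≡ v
⊖-identityʳ [] = refl
⊖-identityʳ (x ∷ v) = cong₂ _∷_ (solve 1 (λ x → x :- con 0ℚ := x) refl x) (⊖-identityʳ v)

-1·≡negV : (v : Vec ℚ n) → (- 1ℚ) · v ≡ negV v
-1·≡negV [] = refl
-1·≡negV (x ∷ v) = cong₂ _∷_ (solve 1 (λ x → (:- con 1ℚ) :* x := :- x) refl x) (-1·≡negV v)

negV-involutive : (v : Vec ℚ n) → negV (negV v) ≡ v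
negV-involutive [] = refl
negV-involutive (x ∷ v) = cong₂ _∷_ (solve 1 (λ x → :- (:- x) := x) refl x) (negV-involutive v)

⊖≡⊕-1· : (a b : Vec ℚ n) → a ⊖ b ≡ a ⊕ (- 1ℚ) · b
⊖≡⊕-1· [] [] = refl
⊖≡⊕-1· (x ∷ a) (y ∷ b) =
  cong₂ _∷_ (solve 2 (λ x y → x :- y := x :+ (:- con 1ℚ) :* y) refl x y) (⊖≡⊕-1· a b)

⊕-cancelʳ : (a b c : Vec ℚ n) → a ⊕ c ≡ b ⊕ c → a ≡ b
⊕-cancelʳ [] [] [] _ = refl
⊕-cancelʳ (x ∷ a) (y ∷ b) (z ∷ c) eq = cong₂ _∷_ head (⊕-cancelʳ a b c (proj₂ (∷-injective eq)))
  where
  head : x ≡ y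
  head = begin
    x               ≡⟨ solve 2 (λ x z → x := (x :+ z) :- z) refl x z ⟩
    (x + z) - z     ≡⟨ cong (_- z) (proj₁ (∷-injective eq)) ⟩
    (y + z) - z     ≡⟨ solve 2 (λ y z → (y :+ z) :- z := y) refl y z ⟩
    y               ∎
    where open ≡-Reasoning

sign : ℕ → ℚ
sign zero = 1ℚ
sign (suc k) = - sign k

sign-+ : ∀ j k → sign (j ℕ.+ k) ≡ sign j * sign k
sign-+ zero k = sym (*-identityˡ (sign k))
sign-+ (suc j) k =
  trans (cong -_ (sign-+ j k)) (solve 2 (λ s t → :- (s :* t) := (:- s) :* t) refl (sign j) (sign k))

sign-square : ∀ k → sign k * sign k ≡ 1ℚ
sign-square zero = refl
sign-square (suc k) = trans (solve 1 (λ s → (:- s) :* (:- s) := s :* s) refl (sign k)) (sign-square k)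

sign-±1 : ∀ k → sign k ≡ 1ℚ ⊎ sign k ≡ - 1ℚ
sign-±1 zero = inj₁ refl
sign-±1 (suc k) with sign-±1 k
... | inj₁ s≡1 = inj₂ (cong -_ s≡1)
... | inj₂ s≡-1 = inj₁ (cong -_ s≡-1)

infixl 5 _∙_

_∙_ : ℚ × Vec ℚ n → ℚ × Vec ℚ n → ℚ × Vec ℚ n
(s , a) ∙ (t , b) = s * t , a ⊕ s · b

ε : ℚ × Vec ℚ n
ε = 1ℚ , zeroV

∙-identityˡ : (x : ℚ × Vec ℚ n) → ε ∙ x ≡ x
∙-identityˡ (t , b) = cong₂ _,_ (*-identityˡ t) (trans (⊕-identityˡ (1ℚ · b)) (·-identityˡ b))

∙-cancelʳ : (x y z : ℚ × Vec ℚ n) → x ∙ z ≡ ε → y ∙ z ≡ ε → x ≡ y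
∙-cancelʳ (s , a) (s′ , a′) (t , c) xz≡ε yz≡ε = cong₂ _,_ s≡s′ a≡a′
  where
  s≡s′ : s ≡ s′
  s≡s′ = begin
    s               ≡⟨ solve 1 (λ s → s := s :* con 1ℚ) refl s ⟩
    s * 1ℚ          ≡⟨ cong (s *_) (sym (cong proj₁ yz≡ε)) ⟩
    s * (s′ * t)    ≡⟨ solve 3 (λ s s′ t → s :* (s′ :* t) := s′ :* (s :* t)) refl s s′ t ⟩
    s′ * (s * t)    ≡⟨ cong (s′ *_) (cong proj₁ xz≡ε) ⟩
    s′ * 1ℚ         ≡⟨ solve 1 (λ s → s :* con 1ℚ := s) refl s′ ⟩
    s′              ∎
    where open ≡-Reasoning
  a≡a′ : a ≡ a′
  a≡a′ = ⊕-cancelʳ a a′ (s · c)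
    (trans (cong proj₂ xz≡ε) (sym (trans (cong (λ k → a′ ⊕ k · c) s≡s′) (cong proj₂ yz≡ε))))

⟪_⟫ : List (Fin n) → ℚ × Vec ℚ n
⟪ es ⟫ = sign (length es) , altVec es

altVec-++ : (xs ys : List (Fin n)) → altVec (xs ++ ys) ≡ altVec xs ⊕ sign (length xs) · altVec ys
altVec-++ [] ys = sym (trans (⊕-identityˡ _) (·-identityˡ (altVec ys)))
altVec-++ (e ∷ xs) ys =
  trans (cong (unitV e ⊖_) (altVec-++ xs ys)) (lemma (unitV e) (altVec xs) (altVec ys))
  where
  lemma : ∀ {n} (u a b : Vec ℚ n) → u ⊖ (a ⊕ sign (length xs) · b) ≡ (u ⊖ a) ⊕ sign (suc (length xs)) · b
  lemma [] [] [] = refl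
  lemma (x ∷ u) (y ∷ a) (z ∷ b) = cong₂ _∷_
    (solve 4 (λ s x y z → x :- (y :+ s :* z) := (x :- y) :+ (:- s) :* z) refl (sign (length xs)) x y z)
    (lemma u a b)

⟪⟫-++ : (xs ys : List (Fin n)) → ⟪ xs ++ ys ⟫ ≡ ⟪ xs ⟫ ∙ ⟪ ys ⟫
⟪⟫-++ xs ys =
  cong₂ _,_ (trans (cong sign (length-++ xs)) (sign-+ (length xs) (length ys))) (altVec-++ xs ys)

⟪⟫-insert : (xs ys zs : List (Fin n)) → ⟪ ys ⟫ ≡ ε → ⟪ xs ++ ys ++ zs ⟫ ≡ ⟪ xs ++ zs ⟫
⟪⟫-insert xs ys zs ys≡ε = begin
  ⟪ xs ++ ys ++ zs ⟫          ≡⟨ ⟪⟫-++ xs (ys ++ zs) ⟩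
  ⟪ xs ⟫ ∙ ⟪ ys ++ zs ⟫       ≡⟨ cong (⟪ xs ⟫ ∙_) (⟪⟫-++ ys zs) ⟩
  ⟪ xs ⟫ ∙ (⟪ ys ⟫ ∙ ⟪ zs ⟫)  ≡⟨ cong (λ y → ⟪ xs ⟫ ∙ (y ∙ ⟪ zs ⟫)) ys≡ε ⟩
  ⟪ xs ⟫ ∙ (ε ∙ ⟪ zs ⟫)       ≡⟨ cong (⟪ xs ⟫ ∙_) (∙-identityˡ ⟪ zs ⟫) ⟩
  ⟪ xs ⟫ ∙ ⟪ zs ⟫             ≡⟨ sym (⟪⟫-++ xs zs) ⟩
  ⟪ xs ++ zs ⟫                ∎
  where open ≡-Reasoning

⟪⟫-backtrack : (e : Fin n) (es : List (Fin n)) → ⟪ e ∷ e ∷ es ⟫ ≡ ⟪ es ⟫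
⟪⟫-backtrack e es =
  cong₂ _,_ (solve 1 (λ s → :- (:- s) := s) refl (sign (length es))) (lemma (unitV e) (altVec es))
  where
  lemma : ∀ {n} (u a : Vec ℚ n) → u ⊖ (u ⊖ a) ≡ a
  lemma [] [] = refl
  lemma (x ∷ u) (y ∷ a) = cong₂ _∷_ (solve 2 (λ x y → x :- (x :- y) := y) refl x y) (lemma u a)

length-<-++ˡ : ∀ {A : Set} (xs : List A) {y ys} → length xs < length (xs ++ y ∷ ys)
length-<-++ˡ [] = s≤s z≤n
length-<-++ˡ (x ∷ xs) = s≤s (length-<-++ˡ xs)

length-<-insert : ∀ {A : Set} (xs ys zs : List A) → ys ≢ [] → length (xs ++ zs) < length (xs ++ ys ++ zs)
length-<-insert [] [] zs ys≢[] = ⊥-elim (ys≢[] refl)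
length-<-insert [] (y ∷ ys) zs _ = s≤s (length-++-≤ʳ zs {ys})
length-<-insert (x ∷ xs) ys zs ys≢[] = s≤s (length-<-insert xs ys zs ys≢[])

private variable
  G : Graph n
  a b d : Fin (suc n)
  e : Fin n

infixr 5 _++ʷ_

_++ʷ_ : Walk G a b → Walk G b d → Walk G a d
[] ++ʷ q = q
step e j p ++ʷ q = step e j (p ++ʷ q)

edgesOf-++ʷ : (p : Walk G a b) (q : Walk G b d) → edgesOf (p ++ʷ q) ≡ edgesOf p ++ edgesOf q
edgesOf-++ʷ [] q = refl
edgesOf-++ʷ (step e j p) q = cong (e ∷_) (edgesOf-++ʷ p q)

⟪⟫-++ʷ : (p : Walk G a b) (q : Walk G b d) → ⟪ edgesOf (p ++ʷ q) ⟫ ≡ ⟪ edgesOf p ⟫ ∙ ⟪ edgesOf q ⟫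
⟪⟫-++ʷ p q = trans (cong ⟪_⟫ (edgesOf-++ʷ p q)) (⟪⟫-++ (edgesOf p) (edgesOf q))

len : Walk G a b → ℕ
len w = length (edgesOf w)

joins-endpoints : ∀ {x y} → Joins G e a b → Joins G e x y → (x ≡ a × y ≡ b) ⊎ (x ≡ b × y ≡ a)
joins-endpoints (inj₁ ab) (inj₁ xy) = inj₁ (cong proj₁ (trans (sym xy) ab) , cong proj₂ (trans (sym xy) ab))
joins-endpoints (inj₁ ab) (inj₂ yx) = inj₂ (cong proj₂ (trans (sym yx) ab) , cong proj₁ (trans (sym yx) ab))
joins-endpoints (inj₂ ba) (inj₁ xy) = inj₂ (cong proj₁ (trans (sym xy) ba) , cong proj₂ (trans (sym xy) ba))
joins-endpoints (inj₂ ba) (inj₂ yx) = inj₁ (cong proj₂ (trans (sym yx) ba) , cong proj₁ (trans (sym yx) ba))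

start∈verts : (w : Walk G a b) → a ∈ verts w
start∈verts [] = here refl
start∈verts (step e j w) = here refl

end∈verts : (w : Walk G a b) → b ∈ verts w
end∈verts [] = here refl
end∈verts (step e j w) = there (end∈verts w)

joins-∈-verts : ∀ {x y} (w : Walk G a b) → e ∈ edgesOf w → Joins G e x y → x ∈ verts w
joins-∈-verts {G = G} (step e j w) (here refl) j′ with joins-endpoints {G = G} j j′
... | inj₁ (refl , _) = here refl
... | inj₂ (refl , _) = there (start∈verts w)
joins-∈-verts (step _ _ w) (there e∈w) j′ = there (joins-∈-verts w e∈w j′)

unique-verts⇒unique-edges : (w : Walk G a b) → Unique (verts w) → Unique (edgesOf w)
unique-verts⇒unique-edges [] _ = []
unique-verts⇒unique-edges (step e j w) (a∉w ∷ distinct) =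
  ¬Any⇒All¬ _ (λ e∈w → All.lookup a∉w (joins-∈-verts w e∈w j) refl) ∷ unique-verts⇒unique-edges w distinct

simple⇒distinct : (w : Walk G a b) → IsSimplePath w → a ≢ b
simple⇒distinct [] (nonempty , _) _ = nonempty refl
simple⇒distinct (step e j w) (_ , a∉w ∷ _) refl = All.lookup a∉w (end∈verts w) refl

split-at : ∀ {x} (w : Walk G a b) → x ∈ verts w →
           Σ (Walk G a x) λ p → Σ (Walk G x b) λ q → edgesOf w ≡ edgesOf p ++ edgesOf q
split-at [] (here refl) = [] , [] , refl
split-at (step e j w) (here refl) = [] , step e j w , refl
split-at (step e j w) (there x∈w) with split-at w x∈w
... | p , q , eq = step e j p , q , cong (e ∷_) eq

record Loop {G : Graph n} (w : Walk G a b) : Set where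
  constructor loop
  field
    {x} : Fin (suc n)
    p : Walk G a x
    c : Walk G x x
    q : Walk G x b
    nonempty : edgesOf c ≢ []
    edges : edgesOf w ≡ edgesOf p ++ edgesOf c ++ edgesOf q

unique-or-loop : (w : Walk G a b) → Unique (verts w) ⊎ Loop w
unique-or-loop [] = inj₁ (All.[] ∷ [])
unique-or-loop {a = a} (step e j w) with any? (a ≟_) (verts w)
... | yes a∈w with split-at w a∈w
...   | p , q , eq = inj₂ (loop [] (step e j p) q (λ ()) (cong (e ∷_) eq))
unique-or-loop {a = a} (step e j w) | no a∉w with unique-or-loop w
... | inj₁ distinct = inj₁ (¬Any⇒All¬ _ a∉w ∷ distinct)
... | inj₂ (loop p c q nonempty eq) = inj₂ (loop (step e j p) c q nonempty (cong (e ∷_) eq))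

record Occurrence {G : Graph n} (e : Fin n) (w : Walk G a b) : Set where
  constructor occurrence
  field
    {x y} : Fin (suc n)
    p : Walk G a x
    joins : Joins G e x y
    q : Walk G y b
    edges : edgesOf w ≡ edgesOf p ++ e ∷ edgesOf q

find-edge : (w : Walk G a b) → e ∈ edgesOf w → Occurrence e w
find-edge (step e j w) (here refl) = occurrence [] j w refl
find-edge (step e j w) (there e∈w) with find-edge w e∈w
... | occurrence p j′ q eq = occurrence (step e j p) j′ q (cong (e ∷_) eq)

record Reducible (G : Graph n) (es : List (Fin n)) : Set where
  constructor reducible
  field
    {x y} : Fin (suc n)
    c₁ : Walk G x x
    c₂ : Walk G y y
    shorter₁ : len c₁ < length es
    shorter₂ : len c₂ < length es
    combine : ⟪ edgesOf c₁ ⟫ ≡ ε → ⟪ edgesOf c₂ ⟫ ≡ ε → ⟪ es ⟫ ≡ ε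

reduce-repeated-edge : (j : Joins G e a b) (w : Walk G b a) → Occurrence e w → Reducible G (e ∷ edgesOf w)
reduce-repeated-edge {G = G} {e = e} {a} {b} j w (occurrence {x} {y} m j′ q eq) =
  subst (Reducible G) (cong (e ∷_) (sym eq)) (by-direction (joins-endpoints {G = G} j j′))
  where
  -- e is traversed again either in the same direction (two closed walks through e) or backwards.
  by-direction : (x ≡ a × y ≡ b) ⊎ (x ≡ b × y ≡ a) → Reducible G (e ∷ edgesOf m ++ e ∷ edgesOf q)
  by-direction (inj₁ (refl , refl)) =
    reducible (step e j m) (step e j′ q)
      (s≤s (length-<-++ˡ (edgesOf m))) (s≤s (length-++-≤ʳ (e ∷ edgesOf q) {edgesOf m}))
      λ e∷m≡ε e∷q≡ε → trans (⟪⟫-insert [] (e ∷ edgesOf m) (e ∷ edgesOf q) e∷m≡ε) e∷q≡ε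
  by-direction (inj₂ (refl , refl)) =
    reducible m q
      (s≤s (length-++-≤ˡ (edgesOf m))) (s≤s (≤-trans (n≤1+n _) (length-++-≤ʳ (e ∷ edgesOf q) {edgesOf m})))
      λ m≡ε q≡ε → trans (⟪⟫-insert (e ∷ []) (edgesOf m) (e ∷ edgesOf q) m≡ε)
                        (trans (⟪⟫-backtrack e (edgesOf q)) q≡ε)

reduce-loop : (j : Joins G e a b) (w : Walk G b a) → Loop w → Reducible G (e ∷ edgesOf w)
reduce-loop {G = G} {e = e} j w (loop p c q nonempty eq) =
  subst (Reducible G) (cong (e ∷_) (sym eq)) (reducible (step e j p ++ʷ q) c shorter₁ shorter₂
    λ pq≡ε c≡ε → trans (⟪⟫-insert (e ∷ edgesOf p) (edgesOf c) (edgesOf q) c≡ε)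
                       (trans (cong ⟪_⟫ (sym (edgesOf-++ʷ (step e j p) q))) pq≡ε))
  where
  shorter₁ : len (step e j p ++ʷ q) < length (e ∷ edgesOf p ++ edgesOf c ++ edgesOf q)
  shorter₁ = subst (_< length (e ∷ edgesOf p ++ edgesOf c ++ edgesOf q))
    (sym (cong length (edgesOf-++ʷ (step e j p) q)))
    (length-<-insert (e ∷ edgesOf p) (edgesOf c) (edgesOf q) nonempty)
  shorter₂ : len c < length (e ∷ edgesOf p ++ edgesOf c ++ edgesOf q)
  shorter₂ = s≤s (≤-trans (length-++-≤ˡ (edgesOf c)) (length-++-≤ʳ (edgesOf c ++ edgesOf q) {edgesOf p}))

reduce : (j : Joins G e a b) (w : Walk G b a) → IsSimpleCycle (step e j w) ⊎ Reducible G (e ∷ edgesOf w)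
reduce {e = e} j w with any? (e ≟_) (edgesOf w)
... | yes e∈w = inj₂ (reduce-repeated-edge j w (find-edge w e∈w))
... | no e∉w with unique-or-loop w
...   | inj₁ distinct = inj₁ ((λ ()) , ¬Any⇒All¬ _ e∉w ∷ unique-verts⇒unique-edges w distinct , distinct)
...   | inj₂ l = inj₂ (reduce-loop j w l)

⟪closed-walk⟫≡ε : Acyclic G → (w : Walk G a a) → ⟪ edgesOf w ⟫ ≡ ε
⟪closed-walk⟫≡ε {G = G} acyclic w = go w (<-wellFounded (len w))
  where
  go : ∀ {a} (w : Walk G a a) → Acc _<_ (len w) → ⟪ edgesOf w ⟫ ≡ ε
  go [] _ = refl
  go (step e j w) (acc rec) with reduce j w
  ... | inj₁ simple = ⊥-elim (acyclic _ (step e j w) simple)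
  ... | inj₂ (reducible c₁ c₂ shorter₁ shorter₂ combine) =
    combine (go c₁ (rec shorter₁)) (go c₂ (rec shorter₂))

walk-nonempty : (w : Walk G a b) → a ≢ b → edgesOf w ≢ []
walk-nonempty [] a≢a _ = a≢a refl
walk-nonempty (step e j w) _ ()

path-between : ∀ {n} {G : Graph n} {a b} → Connected G → a ≢ b → SimplePath G
path-between {G = G} {a} {b} connected a≢b =
  mkPath a b (proj₁ shortened) (proj₂ shortened)
  where
  shorten : (w : Walk G a b) → Acc _<_ (len w) → Σ (Walk G a b) IsSimplePath
  shorten w (acc rec) with unique-or-loop w
  ... | inj₁ distinct = w , walk-nonempty w a≢b , distinct
  ... | inj₂ (loop p c q nonempty eq) = shorten (p ++ʷ q) (rec shorter)
    where
    shorter : len (p ++ʷ q) < len w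
    shorter = subst₂ _<_ (sym (cong length (edgesOf-++ʷ p q))) (sym (cong length eq))
      (length-<-insert (edgesOf p) (edgesOf c) (edgesOf q) nonempty)
  shortened : Σ (Walk G a b) IsSimplePath
  shortened = shorten (connected a b) (<-wellFounded _)

infix 4 _≈±_

_≈±_ : Vec ℚ n → Vec ℚ n → Set
x ≈± y = x ≡ y ⊎ x ≡ negV y

≈±-sym : {x y : Vec ℚ n} → x ≈± y → y ≈± x
≈±-sym (inj₁ refl) = inj₁ refl
≈±-sym (inj₂ refl) = inj₂ (sym (negV-involutive _))

≈±-trans : {x y z : Vec ℚ n} → x ≈± y → y ≈± z → x ≈± z
≈±-trans (inj₁ refl) y≈±z = y≈±z
≈±-trans (inj₂ refl) (inj₁ refl) = inj₂ refl
≈±-trans (inj₂ refl) (inj₂ refl) = inj₁ (negV-involutive _)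

sign-·-≈± : ∀ k (v : Vec ℚ n) → sign k · v ≈± v
sign-·-≈± k v with sign-±1 k
... | inj₁ s≡1 = inj₁ (trans (cong (_· v) s≡1) (·-identityˡ v))
... | inj₂ s≡-1 = inj₂ (trans (cong (_· v) s≡-1) (-1·≡negV v))

combination : ∀ {k} → Vec ℚ k → Vec (Vec ℚ m) k → Vec ℚ m
combination [] [] = zeroV
combination (x ∷ z) (g ∷ gs) = x · g ⊕ combination z gs

record IsLinear (M : Vec ℚ n → Vec ℚ m) : Set where
  field
    map-⊕ : ∀ a b → M (a ⊕ b) ≡ M a ⊕ M b
    map-· : ∀ k a → M (k · a) ≡ k · M a

  map-zeroV : M zeroV ≡ zeroV
  map-zeroV = begin
    M zeroV           ≡⟨ cong M (sym (·-zeroˡ zeroV)) ⟩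
    M (0ℚ · zeroV)    ≡⟨ map-· 0ℚ zeroV ⟩
    0ℚ · M zeroV      ≡⟨ ·-zeroˡ (M zeroV) ⟩
    zeroV             ∎
    where open ≡-Reasoning

  map-⊖ : ∀ a b → M (a ⊖ b) ≡ M a ⊖ M b
  map-⊖ a b = begin
    M (a ⊖ b)                 ≡⟨ cong M (⊖≡⊕-1· a b) ⟩
    M (a ⊕ (- 1ℚ) · b)        ≡⟨ map-⊕ a ((- 1ℚ) · b) ⟩
    M a ⊕ M ((- 1ℚ) · b)      ≡⟨ cong (M a ⊕_) (map-· (- 1ℚ) b) ⟩
    M a ⊕ (- 1ℚ) · M b        ≡⟨ sym (⊖≡⊕-1· (M a) (M b)) ⟩
    M a ⊖ M b                 ∎
    where open ≡-Reasoning

  map-negV : ∀ a → M (negV a) ≡ negV (M a)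
  map-negV a = begin
    M (negV a)         ≡⟨ cong M (sym (-1·≡negV a)) ⟩
    M ((- 1ℚ) · a)     ≡⟨ map-· (- 1ℚ) a ⟩
    (- 1ℚ) · M a       ≡⟨ -1·≡negV (M a) ⟩
    negV (M a)         ∎
    where open ≡-Reasoning

  map-≈± : ∀ {a b} → a ≈± b → M a ≈± M b
  map-≈± (inj₁ refl) = inj₁ refl
  map-≈± {b = b} (inj₂ refl) = inj₂ (map-negV b)

  map-lincomb : ∀ cs vs → M (lincomb cs vs) ≡ lincomb cs (L.map M vs)
  map-lincomb [] vs = map-zeroV
  map-lincomb (c ∷ cs) [] = map-zeroV
  map-lincomb (c ∷ cs) (v ∷ vs) =
    trans (map-⊕ (c · v) (lincomb cs vs)) (cong₂ _⊕_ (map-· c v) (map-lincomb cs vs))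

  map-combination : ∀ {k} (z : Vec ℚ k) gs → M (combination z gs) ≡ combination z (V.map M gs)
  map-combination [] [] = map-zeroV
  map-combination (x ∷ z) (g ∷ gs) =
    trans (map-⊕ (x · g) (combination z gs)) (cong₂ _⊕_ (map-· x g) (map-combination z gs))

combination-linear : ∀ {k} (gs : Vec (Vec ℚ m) k) → IsLinear (λ z → combination z gs)
combination-linear gs = record { map-⊕ = λ a b → map-⊕ a b gs ; map-· = λ k a → map-· k a gs }
  where
  map-⊕ : ∀ {k} (a b : Vec ℚ k) gs → combination (a ⊕ b) gs ≡ combination a gs ⊕ combination b gs
  map-⊕ [] [] [] = sym (⊕-identityˡ zeroV)
  map-⊕ (x ∷ a) (y ∷ b) (g ∷ gs) = trans (cong ((x + y) · g ⊕_) (map-⊕ a b gs)) (lemma g _ _)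
    where
    lemma : ∀ {m} (g c d : Vec ℚ m) → (x + y) · g ⊕ (c ⊕ d) ≡ (x · g ⊕ c) ⊕ (y · g ⊕ d)
    lemma [] [] [] = refl
    lemma (g ∷ gs) (c ∷ cs) (d ∷ ds) = cong₂ _∷_
      (solve 5 (λ x y g c d → (x :+ y) :* g :+ (c :+ d) := (x :* g :+ c) :+ (y :* g :+ d)) refl x y g c d)
      (lemma gs cs ds)
  map-· : ∀ {k} t (a : Vec ℚ k) gs → combination (t · a) gs ≡ t · combination a gs
  map-· t [] [] = sym (·-zeroʳ t)
  map-· t (x ∷ a) (g ∷ gs) = trans (cong ((t * x) · g ⊕_) (map-· t a gs)) (lemma g _)
    where
    lemma : ∀ {m} (g c : Vec ℚ m) → (t * x) · g ⊕ t · c ≡ t · (x · g ⊕ c)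
    lemma [] [] = refl
    lemma (g ∷ gs) (c ∷ cs) = cong₂ _∷_
      (solve 4 (λ t x g c → (t :* x) :* g :+ t :* c := t :* (x :* g :+ c)) refl t x g c) (lemma gs cs)

∘-linear : {M : Vec ℚ n → Vec ℚ m} {M′ : Vec ℚ m → Vec ℚ n} →
           IsLinear M → IsLinear M′ → IsLinear (λ z → M′ (M z))
∘-linear {M = M} {M′} linear linear′ = record
  { map-⊕ = λ a b → trans (cong M′ (map-⊕ a b)) (IsLinear.map-⊕ linear′ (M a) (M b))
  ; map-· = λ k a → trans (cong M′ (map-· k a)) (IsLinear.map-· linear′ k (M a))
  }
  where open IsLinear linear

unitV-zero : ∀ {k} → unitV {suc k} zero ≡ 1ℚ ∷ zeroV
unitV-zero = cong (1ℚ ∷_) (trans (tabulate-allFin _) (map-const _ 0ℚ))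

unitV-suc : ∀ {k} (i : Fin k) → unitV (suc i) ≡ 0ℚ ∷ unitV i
unitV-suc {k} i = cong (0ℚ ∷_) (tabulate-cong same)
  where
  same : ∀ (j : Fin k) → (if ⌊ suc j ≟ suc i ⌋ then 1ℚ else 0ℚ) ≡ (if ⌊ j ≟ i ⌋ then 1ℚ else 0ℚ)
  same j with j ≟ i
  ... | yes _ = refl
  ... | no _ = refl

combination-unitV : ∀ {k} (i : Fin k) (gs : Vec (Vec ℚ m) k) → combination (unitV i) gs ≡ V.lookup gs i
combination-unitV zero (g ∷ gs) = begin
  combination (unitV zero) (g ∷ gs)  ≡⟨ cong (λ u → combination u (g ∷ gs)) unitV-zero ⟩
  1ℚ · g ⊕ combination zeroV gs      ≡⟨ cong₂ _⊕_ (·-identityˡ g) (IsLinear.map-zeroV (combination-linear gs)) ⟩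
  g ⊕ zeroV                          ≡⟨ ⊕-identityʳ g ⟩
  g                                  ∎
  where open ≡-Reasoning
combination-unitV (suc i) (g ∷ gs) = begin
  combination (unitV (suc i)) (g ∷ gs)  ≡⟨ cong (λ u → combination u (g ∷ gs)) (unitV-suc i) ⟩
  0ℚ · g ⊕ combination (unitV i) gs     ≡⟨ cong₂ _⊕_ (·-zeroˡ g) (combination-unitV i gs) ⟩
  zeroV ⊕ V.lookup gs i                 ≡⟨ ⊕-identityˡ (V.lookup gs i) ⟩
  V.lookup gs i                         ∎
  where open ≡-Reasoning

combination-0∷ : ∀ {k} (z : Vec ℚ k) (f : Fin k → Vec ℚ m) →
                 combination z (V.tabulate (λ i → 0ℚ ∷ f i)) ≡ 0ℚ ∷ combination z (V.tabulate f)
combination-0∷ [] f = refl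
combination-0∷ (y ∷ z) f = trans (cong (y · (0ℚ ∷ f zero) ⊕_) (combination-0∷ z (λ i → f (suc i))))
  (cong (_∷ y · f zero ⊕ combination z (V.tabulate (λ i → f (suc i))))
        (solve 1 (λ y → y :* con 0ℚ :+ con 0ℚ := con 0ℚ) refl y))

combination-basis : ∀ {k} (z : Vec ℚ k) → combination z (V.tabulate unitV) ≡ z
combination-basis [] = refl
combination-basis (x ∷ z) = begin
  x · unitV zero ⊕ combination z (V.tabulate (λ i → unitV (suc i)))
    ≡⟨ cong (λ gs → x · unitV zero ⊕ combination z gs) (tabulate-cong unitV-suc) ⟩
  x · unitV zero ⊕ combination z (V.tabulate (λ i → 0ℚ ∷ unitV i))
    ≡⟨ cong₂ (λ u c → x · u ⊕ c) unitV-zero (combination-0∷ z unitV) ⟩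
  (x * 1ℚ + 0ℚ) ∷ (x · zeroV ⊕ combination z (V.tabulate unitV))
    ≡⟨ cong₂ _∷_ (solve 1 (λ x → x :* con 1ℚ :+ con 0ℚ := x) refl x)
                 (trans (cong₂ _⊕_ (·-zeroʳ x) (combination-basis z)) (⊕-identityˡ z)) ⟩
  x ∷ z                                                                ∎
  where open ≡-Reasoning

linear-fixing-basis : {M : Vec ℚ n → Vec ℚ n} → IsLinear M →
                      (∀ i → M (unitV i) ≡ unitV i) → ∀ z → M z ≡ z
linear-fixing-basis {M = M} linear fixes z = begin
  M z                                             ≡⟨ cong M (sym (combination-basis z)) ⟩
  M (combination z (V.tabulate unitV))           ≡⟨ map-combination z (V.tabulate unitV) ⟩
  combination z (V.map M (V.tabulate unitV))     ≡⟨ cong (combination z) (sym (tabulate-∘ M unitV)) ⟩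
  combination z (V.tabulate (λ i → M (unitV i))) ≡⟨ cong (combination z) (tabulate-cong fixes) ⟩
  combination z (V.tabulate unitV)               ≡⟨ combination-basis z ⟩
  z                                               ∎
  where
  open ≡-Reasoning
  open IsLinear linear

LinIndep-map : {M : Vec ℚ n → Vec ℚ m} → IsLinear M → Injective _≡_ _≡_ M →
               (vs : List (Vec ℚ n)) → LinIndep vs ⇔ LinIndep (L.map M vs)
LinIndep-map {M = M} linear injective vs = mk⇔ to from
  where
  open IsLinear linear
  to : LinIndep vs → LinIndep (L.map M vs)
  to independent cs length≡ combination≡0 = independent cs (trans length≡ (length-map M vs))
    (injective (trans (map-lincomb cs vs) (trans combination≡0 (sym map-zeroV))))
  from : LinIndep (L.map M vs) → LinIndep vs
  from independent cs length≡ combination≡0 = independent cs (trans length≡ (sym (length-map M vs)))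
    (trans (sym (map-lincomb cs vs)) (trans (cong M combination≡0) map-zeroV))

module Potential {n} (G : Graph n) (tree : IsTree G) (r : Fin (suc n)) where

  potential : Fin (suc n) → ℚ × Vec ℚ n
  potential x = ⟪ edgesOf (proj₁ tree r x) ⟫

  sgn : Fin (suc n) → ℚ
  sgn x = proj₁ (potential x)

  pot : Fin (suc n) → Vec ℚ n
  pot x = proj₂ (potential x)

  sgn-square : ∀ x → sgn x * sgn x ≡ 1ℚ
  sgn-square x = sign-square (len (proj₁ tree r x))

  potential-root : potential r ≡ ε
  potential-root = ⟪closed-walk⟫≡ε (proj₂ tree) (proj₁ tree r r)

  potential-walk : ∀ {x y} (w : Walk G x y) → potential x ∙ ⟪ edgesOf w ⟫ ≡ potential y
  potential-walk {x} {y} w = trans (sym (⟪⟫-++ʷ (proj₁ tree r x) w))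
    (∙-cancelʳ _ _ _ (returns (proj₁ tree r x ++ʷ w)) (returns (proj₁ tree r y)))
    where
    returns : (v : Walk G r y) → ⟪ edgesOf v ⟫ ∙ ⟪ edgesOf (proj₁ tree y r) ⟫ ≡ ε
    returns v =
      trans (sym (⟪⟫-++ʷ v (proj₁ tree y r))) (⟪closed-walk⟫≡ε (proj₂ tree) (v ++ʷ proj₁ tree y r))

  altVec-walk : ∀ {x y} (w : Walk G x y) → altVec (edgesOf w) ≡ sgn x · (pot y ⊖ pot x)
  altVec-walk {x} {y} w = solve-for (pot x) (altVec (edgesOf w)) (pot y) (cong proj₂ (potential-walk w))
    where
    s : ℚ
    s = sgn x
    solve-for : ∀ {k} (c a d : Vec ℚ k) → c ⊕ s · a ≡ d → a ≡ s · (d ⊖ c)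
    solve-for [] [] [] _ = refl
    solve-for (c ∷ cs) (a ∷ as) (d ∷ ds) eq = cong₂ _∷_ head (solve-for cs as ds (proj₂ (∷-injective eq)))
      where
      head : a ≡ s * (d - c)
      head = begin
        a                    ≡⟨ solve 1 (λ a → a := con 1ℚ :* a) refl a ⟩
        1ℚ * a               ≡⟨ cong (_* a) (sym (sgn-square x)) ⟩
        (s * s) * a          ≡⟨ solve 3 (λ s a c → (s :* s) :* a := s :* ((c :+ s :* a) :- c)) refl s a c ⟩
        s * ((c + s * a) - c) ≡⟨ cong (λ t → s * (t - c)) (proj₁ (∷-injective eq)) ⟩
        s * (d - c)          ∎
        where open ≡-Reasoning

  sgn-step : ∀ {e x y} → Joins G e x y → sgn y ≡ - sgn x
  sgn-step {e} {x} j = trans (sym (cong proj₁ (potential-walk (step e j []))))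
    (solve 1 (λ s → s :* (:- con 1ℚ) := :- s) refl (sgn x))

  normal≈±pot : (p : SimplePath G) → normal p ≈± pot (end p) ⊖ pot (start p)
  normal≈±pot p = subst (_≈± pot (end p) ⊖ pot (start p)) (sym (altVec-walk (walk p)))
    (sign-·-≈± (len (proj₁ tree r (start p))) _)

module Transfer {n m} (G : Graph n) (tree : IsTree G) (r : Fin (suc n)) (φ : Fin (suc n) → Vec ℚ m) where
  open Potential G tree r

  -- Forced by transfer ∘ pot = φ, since e_i = sgn x · (pot y ⊖ pot x) for the edge i = (x , y).
  image : Fin n → Vec ℚ m
  image i = sgn (proj₁ (G i)) · (φ (proj₂ (G i)) ⊖ φ (proj₁ (G i)))

  transfer : Vec ℚ n → Vec ℚ m
  transfer z = combination z (V.tabulate image)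

  transfer-linear : IsLinear transfer
  transfer-linear = combination-linear (V.tabulate image)

  open IsLinear transfer-linear

  transfer-unitV : ∀ {e a b} → Joins G e a b → transfer (unitV e) ≡ sgn a · (φ b ⊖ φ a)
  transfer-unitV {e} j = trans (combination-unitV e _) (trans (lookup∘tabulate image e) (image-joins j))
    where
    image-joins : ∀ {a b} → Joins G e a b → image e ≡ sgn a · (φ b ⊖ φ a)
    image-joins (inj₁ Ge≡ab) rewrite Ge≡ab = refl
    image-joins {a} {b} j@(inj₂ Ge≡ba) rewrite Ge≡ba =
      trans (cong (_· (φ a ⊖ φ b)) (sgn-step j)) (swap (sgn a) (φ a) (φ b))
      where
      swap : ∀ {k} s (x y : Vec ℚ k) → (- s) · (x ⊖ y) ≡ s · (y ⊖ x)
      swap s [] [] = refl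
      swap s (x ∷ xs) (y ∷ ys) = cong₂ _∷_
        (solve 3 (λ s x y → (:- s) :* (x :- y) := s :* (y :- x)) refl s x y) (swap s xs ys)

  transfer-altVec : ∀ {a b} (w : Walk G a b) → transfer (altVec (edgesOf w)) ≡ sgn a · (φ b ⊖ φ a)
  transfer-altVec {a} [] = trans map-zeroV (sym (vanish (sgn a) (φ a)))
    where
    vanish : ∀ {k} s (x : Vec ℚ k) → s · (x ⊖ x) ≡ zeroV
    vanish s [] = refl
    vanish s (x ∷ xs) = cong₂ _∷_ (solve 2 (λ s x → s :* (x :- x) := con 0ℚ) refl s x) (vanish s xs)
  transfer-altVec {a} {b} (step {b = c} e j w) = begin
    transfer (unitV e ⊖ altVec (edgesOf w))
      ≡⟨ map-⊖ (unitV e) (altVec (edgesOf w)) ⟩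
    transfer (unitV e) ⊖ transfer (altVec (edgesOf w))
      ≡⟨ cong₂ _⊖_ (transfer-unitV j) (transfer-altVec w) ⟩
    sgn a · (φ c ⊖ φ a) ⊖ sgn c · (φ b ⊖ φ c)
      ≡⟨ cong (λ s → sgn a · (φ c ⊖ φ a) ⊖ s · (φ b ⊖ φ c)) (sgn-step j) ⟩
    sgn a · (φ c ⊖ φ a) ⊖ (- sgn a) · (φ b ⊖ φ c)
      ≡⟨ telescope (sgn a) (φ a) (φ c) (φ b) ⟩
    sgn a · (φ b ⊖ φ a)
      ∎
    where
    open ≡-Reasoning
    telescope : ∀ {k} s (x y z : Vec ℚ k) → s · (y ⊖ x) ⊖ (- s) · (z ⊖ y) ≡ s · (z ⊖ x)
    telescope s [] [] [] = refl
    telescope s (x ∷ xs) (y ∷ ys) (z ∷ zs) = cong₂ _∷_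
      (solve 4 (λ s x y z → s :* (y :- x) :- (:- s) :* (z :- y) := s :* (z :- x)) refl s x y z)
      (telescope s xs ys zs)

  transfer-pot : φ r ≡ zeroV → ∀ x → transfer (pot x) ≡ φ x
  transfer-pot φr≡0 x = begin
    transfer (pot x)       ≡⟨ transfer-altVec (proj₁ tree r x) ⟩
    sgn r · (φ x ⊖ φ r)    ≡⟨ cong₂ (λ s v → s · (φ x ⊖ v)) (cong proj₁ potential-root) φr≡0 ⟩
    1ℚ · (φ x ⊖ zeroV)     ≡⟨ ·-identityˡ (φ x ⊖ zeroV) ⟩
    φ x ⊖ zeroV            ≡⟨ ⊖-identityʳ (φ x) ⟩
    φ x                    ∎
    where open ≡-Reasoning

map-index : ∀ {A B : Set} (f : A → B) (xs : List A) → Fin (length xs) ⤖ Fin (length (L.map f xs))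
map-index f xs =
  ↔⇒⤖ (mk↔ₛ′ (cast eq) (cast (sym eq)) (cast-involutive eq (sym eq)) (cast-involutive (sym eq) eq))
  where
  eq : length xs ≡ length (L.map f xs)
  eq = sym (length-map f xs)

lookup-map-index : ∀ {A B : Set} (f : A → B) (xs : List A) (i : Fin (length xs)) →
                   lookup (L.map f xs) (Bijection.to (map-index f xs) i) ≡ f (lookup xs i)
lookup-map-index f (x ∷ xs) zero = refl
lookup-map-index f (x ∷ xs) (suc i) = lookup-map-index f xs i

IsMatroidIso-map : {M : Vec ℚ n → Vec ℚ n} → IsLinear M → Injective _≡_ _≡_ M →
                   (S : List (Vec ℚ n)) → IsMatroidIso S (L.map M S) (map-index M S)
IsMatroidIso-map {M = M} linear injective S X _ =
  subst (λ ws → LinIndep (L.map (lookup S) X) ⇔ LinIndep ws) (sym reindexed)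
    (LinIndep-map linear injective (L.map (lookup S) X))
  where
  reindexed : L.map (λ i → lookup (L.map M S) (Bijection.to (map-index M S) i)) X
            ≡ L.map M (L.map (lookup S) X)
  reindexed = trans (map-cong (lookup-map-index M S) X) (map-∘ X)

NormalChoice-map : {G₁ G₂ : Graph n} {M : Vec ℚ n → Vec ℚ n} → IsLinear M → Injective _≡_ _≡_ M →
  ((p : SimplePath G₁) → Σ (SimplePath G₂) λ p′ → ∀ {y} → y ≈± normal p → M y ≈± normal p′) →
  ((p′ : SimplePath G₂) → Σ (SimplePath G₁) λ p → ∀ {y} → y ≈± normal p → M y ≈± normal p′) →
  ∀ {S} → NormalChoice G₁ S → NormalChoice G₂ (L.map M S)
NormalChoice-map {G₁ = G₁} {G₂} {M} linear injective forward backward {S}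
                 (unique , normals , covers , one-sided) =
  map⁺ injective unique , normals′ , covers′ , one-sided′
  where
  open IsLinear linear

  normals′ : ∀ {x} → x ∈ L.map M S → Σ (SimplePath G₂) (IsNormalOf x)
  normals′ x∈ with ∈-map⁻ M x∈
  ... | y , y∈S , refl with normals y∈S
  ...   | p , y≈±p = proj₁ (forward p) , proj₂ (forward p) y≈±p

  member : ∀ {x y} → y ∈ S → M y ≈± x → x ∈ L.map M S ⊎ negV x ∈ L.map M S
  member y∈S (inj₁ My≡x) = inj₁ (subst (_∈ L.map M S) My≡x (∈-map⁺ M y∈S))
  member y∈S (inj₂ My≡-x) = inj₂ (subst (_∈ L.map M S) My≡-x (∈-map⁺ M y∈S))

  covers′ : (p′ : SimplePath G₂) → normal p′ ∈ L.map M S ⊎ negV (normal p′) ∈ L.map M S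
  covers′ p′ with backward p′
  ... | p , preserves with covers p
  ...   | inj₁ n∈S = member n∈S (preserves (inj₁ refl))
  ...   | inj₂ -n∈S = member -n∈S (preserves (inj₂ refl))

  one-sided′ : (p′ : SimplePath G₂) → ¬ (normal p′ ∈ L.map M S × negV (normal p′) ∈ L.map M S)
  one-sided′ p′ (n∈ , -n∈) with ∈-map⁻ M n∈ | ∈-map⁻ M -n∈
  ... | y , y∈S , n≡My | y′ , y′∈S , -n≡My′ = opposite (normals y∈S) (subst (_∈ S) y′≡-y y′∈S)
    where
    y′≡-y : y′ ≡ negV y
    y′≡-y = injective (trans (sym -n≡My′) (trans (cong negV n≡My) (sym (map-negV y))))
    opposite : Σ (SimplePath G₁) (IsNormalOf y) → negV y ∈ S → ⊥
    opposite (q , inj₁ refl) -y∈S = one-sided q (y∈S , -y∈S)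
    opposite (q , inj₂ refl) -y∈S = one-sided q (subst (_∈ S) (negV-involutive _) -y∈S , y∈S)

transpose-sends : ∀ {k} (i j : Fin k) → transpose i j i ≡ j
transpose-sends i j rewrite dec-true (i ≟ i) refl = refl

module Correspondence {n} (G₁ G₂ : Graph n) (tree₁ : IsTree G₁) (tree₂ : IsTree G₂) (u v : Fin (suc n)) where

  σ σ⁻¹ : Fin (suc n) → Fin (suc n)
  σ = transpose u v
  σ⁻¹ = transpose v u

  σ-distinct : ∀ {a b} → a ≢ b → σ a ≢ σ b
  σ-distinct a≢b σa≡σb =
    a≢b (trans (sym (transpose-inverse v u)) (trans (cong σ⁻¹ σa≡σb) (transpose-inverse v u)))

  σ⁻¹-distinct : ∀ {a b} → a ≢ b → σ⁻¹ a ≢ σ⁻¹ b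
  σ⁻¹-distinct a≢b σ⁻¹a≡σ⁻¹b =
    a≢b (trans (sym (transpose-inverse u v)) (trans (cong σ σ⁻¹a≡σ⁻¹b) (transpose-inverse u v)))

  module P₁ = Potential G₁ tree₁ u
  module P₂ = Potential G₂ tree₂ v
  module T₁ = Transfer G₁ tree₁ u (λ x → P₂.pot (σ x))
  module T₂ = Transfer G₂ tree₂ v (λ y → P₁.pot (σ⁻¹ y))

  Λ Λ⁻¹ : Vec ℚ n → Vec ℚ n
  Λ = T₁.transfer
  Λ⁻¹ = T₂.transfer

  Λ-linear : IsLinear Λ
  Λ-linear = T₁.transfer-linear

  Λ-difference : ∀ a b → Λ (P₁.pot b ⊖ P₁.pot a) ≡ P₂.pot (σ b) ⊖ P₂.pot (σ a)
  Λ-difference a b = trans (IsLinear.map-⊖ Λ-linear (P₁.pot b) (P₁.pot a)) (cong₂ _⊖_ (Λ-pot b) (Λ-pot a))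
    where
    Λ-pot : ∀ x → Λ (P₁.pot x) ≡ P₂.pot (σ x)
    Λ-pot = T₁.transfer-pot (trans (cong P₂.pot (transpose-sends u v)) (cong proj₂ P₂.potential-root))

  Λ⁻¹-difference : ∀ a b → Λ⁻¹ (P₂.pot (σ b) ⊖ P₂.pot (σ a)) ≡ P₁.pot b ⊖ P₁.pot a
  Λ⁻¹-difference a b = trans (IsLinear.map-⊖ T₂.transfer-linear (P₂.pot (σ b)) (P₂.pot (σ a)))
                             (cong₂ _⊖_ (Λ⁻¹-pot b) (Λ⁻¹-pot a))
    where
    Λ⁻¹-pot : ∀ x → Λ⁻¹ (P₂.pot (σ x)) ≡ P₁.pot x
    Λ⁻¹-pot x = trans (T₂.transfer-pot root₁ (σ x)) (cong P₁.pot (transpose-inverse v u))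
      where
      root₁ : P₁.pot (σ⁻¹ v) ≡ zeroV
      root₁ = trans (cong P₁.pot (transpose-sends v u)) (cong proj₂ P₁.potential-root)

  Λ⁻¹-Λ-unitV : ∀ i → Λ⁻¹ (Λ (unitV i)) ≡ unitV i
  Λ⁻¹-Λ-unitV i = begin
    Λ⁻¹ (Λ (unitV i))
      ≡⟨ cong Λ⁻¹ (T₁.transfer-unitV (inj₁ refl)) ⟩
    Λ⁻¹ (P₁.sgn x₀ · (P₂.pot (σ x₁) ⊖ P₂.pot (σ x₀)))
      ≡⟨ IsLinear.map-· T₂.transfer-linear (P₁.sgn x₀) (P₂.pot (σ x₁) ⊖ P₂.pot (σ x₀)) ⟩
    P₁.sgn x₀ · Λ⁻¹ (P₂.pot (σ x₁) ⊖ P₂.pot (σ x₀))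
      ≡⟨ cong (P₁.sgn x₀ ·_) (Λ⁻¹-difference x₀ x₁) ⟩
    P₁.sgn x₀ · (P₁.pot x₁ ⊖ P₁.pot x₀)
      ≡⟨ sym (P₁.altVec-walk (step i (inj₁ refl) [])) ⟩
    unitV i ⊖ zeroV
      ≡⟨ ⊖-identityʳ (unitV i) ⟩
    unitV i
      ∎
    where
    open ≡-Reasoning
    x₀ x₁ : Fin (suc n)
    x₀ = proj₁ (G₁ i)
    x₁ = proj₂ (G₁ i)

  Λ-injective : Injective _≡_ _≡_ Λ
  Λ-injective {x} {y} Λx≡Λy = trans (sym (Λ⁻¹-Λ x)) (trans (cong Λ⁻¹ Λx≡Λy) (Λ⁻¹-Λ y))
    where
    Λ⁻¹-Λ : ∀ z → Λ⁻¹ (Λ z) ≡ z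
    Λ⁻¹-Λ = linear-fixing-basis (∘-linear Λ-linear T₂.transfer-linear) Λ⁻¹-Λ-unitV

  Λ-normal : ∀ {y} (p : SimplePath G₁) (p′ : SimplePath G₂) →
             start p′ ≡ σ (start p) → end p′ ≡ σ (end p) → y ≈± normal p → Λ y ≈± normal p′
  Λ-normal p p′ refl refl y≈±p =
    ≈±-trans (map-≈± y≈±p) (≈±-trans (map-≈± (P₁.normal≈±pot p))
      (subst (_≈± normal p′) (sym (Λ-difference (start p) (end p))) (≈±-sym (P₂.normal≈±pot p′))))
    where open IsLinear Λ-linear

  image-path : SimplePath G₁ → SimplePath G₂
  image-path p = path-between (proj₁ tree₂) (σ-distinct (simple⇒distinct (walk p) (simple p)))

  preimage-path : SimplePath G₂ → SimplePath G₁
  preimage-path p′ = path-between (proj₁ tree₁) (σ⁻¹-distinct (simple⇒distinct (walk p′) (simple p′)))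

  Λ-NormalChoice : ∀ {S} → NormalChoice G₁ S → NormalChoice G₂ (L.map Λ S)
  Λ-NormalChoice = NormalChoice-map Λ-linear Λ-injective
    (λ p → image-path p , Λ-normal p (image-path p) refl refl)
    (λ p′ → preimage-path p′ ,
      Λ-normal (preimage-path p′) p′ (sym (transpose-inverse u v)) (sym (transpose-inverse u v)))

  σ-endpoint : ∀ (p : SimplePath G₁) → (start p ≡ u) ⊎ (end p ≡ u) →
               (start (image-path p) ≡ v) ⊎ (end (image-path p) ≡ v)
  σ-endpoint p = ⊎-map (λ start≡u → trans (cong σ start≡u) (transpose-sends u v))
                       (λ end≡u → trans (cong σ end≡u) (transpose-sends u v))

lemma1 : ∀ (n : ℕ) (G₁ G₂ : Graph n) → IsTree G₁ → IsTree G₂ →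
    (u v : Fin (suc n)) (S₁ : List (Vec ℚ n)) →
    NormalChoice G₁ S₁ →
    (∀ (p : SimplePath G₁) → length (edgesOf (walk p)) ≡ 1 → normal p ∈ S₁) →
    (∀ (p : SimplePath G₁) → start p ≡ u → normal p ∈ S₁) →
    Σ (List (Vec ℚ n)) (λ S₂ →
      NormalChoice G₂ S₂ ×
      Σ (Fin (length S₁) ⤖ Fin (length S₂)) (λ F →
        IsMatroidIso S₁ S₂ F ×
        (∀ (i : Fin (length S₁)) → CorrEndpoint G₁ u (lookup S₁ i) →
          CorrEndpoint G₂ v (lookup S₂ (Bijection.to F i)))))
lemma1 n G₁ G₂ tree₁ tree₂ u v S₁ choice₁ _ _ =
  L.map Λ S₁ , Λ-NormalChoice choice₁ , map-index Λ S₁ , IsMatroidIso-map Λ-linear Λ-injective S₁ , endpoints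
  where
  -- The two ignored sign conventions on S₁ are not needed: Λ sends each normal to ± a normal,
  -- and CorrEndpoint accepts either sign.
  open Correspondence G₁ G₂ tree₁ tree₂ u v
  endpoints : ∀ i → CorrEndpoint G₁ u (lookup S₁ i) →
              CorrEndpoint G₂ v (lookup (L.map Λ S₁) (Bijection.to (map-index Λ S₁) i))
  endpoints i (p , at-u , y≈±p) =
    image-path p , σ-endpoint p at-u ,
    subst (_≈± normal (image-path p)) (sym (lookup-map-index Λ S₁ i))
      (Λ-normal p (image-path p) refl refl y≈±p)
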